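{- Let $H=(h_{ij})_{i,j=1}^{g\lambda}$ be a generalized Hadamard matrix $GH(g,\lambda)$ over a finite abelian group of order $g$ with permutation representation $\phi$, and for $k\in\{1,\ldots,g\lambda\}$ let $C_k=(\phi(-h_{ki}+h_{kj}))_{i,j=1}^{g\lambda}$, a matrix of order $g^2\lambda$. Then (i) $\sum_{k=1}^{g\lambda}C_k=g\lambda I_{g\lambda}\otimes I_g+\lambda(J_{g\lambda}-I_{g\lambda})\otimes J_g$; (ii) $C_kC_k^\top=g\lambda C_k$ for every $k$; (iii) $C_kC_{k'}^\top=\lambda J_{g^2\lambda}$ for all distinct $k,k'$.
   Context: $I_n,J_n$ denote the identity and all-ones matrices of order $n$; $\otimes$ is the Kronecker product. A generalized Hadamard matrix $GH(g,\lambda)$ over an additively written abelian group $G$ of order $g$ is a square matrix $H=(h_{ij})$ of order $g\lambda$ with entries in $G$ such that for all distinct rows $i,k$ the multiset $\{h_{ij}-h_{kj}:1\le j\le g\lambda\}$ contains each element of $G$ exactly $\lambda$ times. Write $G\cong\mathbb{Z}_{n_1}\oplus\cdots\oplus\mathbb{Z}_{n_s}$, so $g=n_1\cdots n_s$; let $r_p$ be the $p\times p$ circulant permutation matrix with first row $(0,1,0,\ldots,0)$; the permutation representation is $\phi((x_i)_{i=1}^s)=r_{n_1}^{x_1}\otimes\cdots\otimes r_{n_s}^{x_s}$, a $g\times g$ permutation matrix. -}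

module Defs where

open import Data.Nat as ℕ using (ℕ; zero; suc; NonZero)
open import Data.Nat.DivMod using (_mod_)
open import Data.Fin as Fin using (Fin; toℕ; combine; remQuot; quotient; remainder)
open import Data.Fin.Properties using () renaming (_≟_ to _≟F_)
open import Data.Integer as ℤ using (ℤ; +_)
open import Data.List using (List; []; _∷_)
open import Data.Product using (_×_; _,_; proj₁; proj₂)
open import Data.Unit using (⊤; tt)
open import Data.Bool using (Bool; true; false; if_then_else_; _∧_)
open import Relation.Nullary using (does)
open import Relation.Binary.PropositionalEquality using (_≡_; _≢_)

addZ : ∀ {n} → Fin n → Fin n → Fin n
addZ {suc k} a b = (toℕ a ℕ.+ toℕ b) mod (suc k)

negZ : ∀ {n} → Fin n → Fin n
negZ {suc k} a = (suc k ℕ.∸ toℕ a) mod (suc k)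

-- G = Z_{n_1} ⊕ ... ⊕ Z_{n_s}, for a list of moduli ns = n_1 ∷ ... ∷ n_s

Grp : List ℕ → Set
Grp []       = ⊤
Grp (n ∷ ns) = Fin n × Grp ns

order : List ℕ → ℕ
order []       = 1
order (n ∷ ns) = n ℕ.* order ns

_⊕_ : ∀ {ns} → Grp ns → Grp ns → Grp ns
_⊕_ {[]}     _       _       = tt
_⊕_ {n ∷ ns} (a , x) (b , y) = addZ a b , (x ⊕ y)

⊖_ : ∀ {ns} → Grp ns → Grp ns
⊖_ {[]}     _       = tt
⊖_ {n ∷ ns} (a , x) = negZ a , (⊖ x)

_⊝_ : ∀ {ns} → Grp ns → Grp ns → Grp ns
x ⊝ y = x ⊕ (⊖ y)

eqG : ∀ {ns} → Grp ns → Grp ns → Bool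
eqG {[]}     _       _       = true
eqG {n ∷ ns} (a , x) (b , y) = does (a ≟F b) ∧ eqG x y

count : ∀ {m} → (Fin m → Bool) → ℕ
count {zero}  P = 0
count {suc m} P = (if P Fin.zero then 1 else 0) ℕ.+ count (λ j → P (Fin.suc j))

IsGH : (ns : List ℕ) (λ' : ℕ) →
       (Fin (order ns ℕ.* λ') → Fin (order ns ℕ.* λ') → Grp ns) → Set
IsGH ns λ' H =
  ∀ (i k : Fin (order ns ℕ.* λ')) → i ≢ k → ∀ (x : Grp ns) →
    count (λ j → eqG (H i j ⊝ H k j) x) ≡ λ'

Mat : ℕ → ℕ → Set
Mat m n = Fin m → Fin n → ℤ

sumFin : ∀ {m} → (Fin m → ℤ) → ℤ
sumFin {zero}  f = + 0
sumFin {suc m} f = f Fin.zero ℤ.+ sumFin (λ j → f (Fin.suc j))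

_≈M_ : ∀ {m n} → Mat m n → Mat m n → Set
A ≈M B = ∀ i j → A i j ≡ B i j

_+M_ : ∀ {m n} → Mat m n → Mat m n → Mat m n
(A +M B) i j = A i j ℤ.+ B i j

_-M_ : ∀ {m n} → Mat m n → Mat m n → Mat m n
(A -M B) i j = A i j ℤ.- B i j

_·M_ : ∀ {m n} → ℤ → Mat m n → Mat m n
(c ·M A) i j = c ℤ.* A i j

_*M_ : ∀ {m n p} → Mat m n → Mat n p → Mat m p
(A *M B) i k = sumFin (λ j → A i j ℤ.* B j k)

_ᵀ : ∀ {m n} → Mat m n → Mat n m
(A ᵀ) i j = A j i

δ : ∀ {n} → Fin n → Fin n → ℤ
δ i j = if does (i ≟F j) then + 1 else + 0

I : ∀ n → Mat n n
I n = δ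

J : ∀ m n → Mat m n
J m n _ _ = + 1

sumM : ∀ {k m n} → (Fin k → Mat m n) → Mat m n
sumM F i j = sumFin (λ t → F t i j)

-- Kronecker product; row index combine i a ↔ (i , a)
_⊗_ : ∀ {m n p q} → Mat m n → Mat p q → Mat (m ℕ.* p) (n ℕ.* q)
_⊗_ {m} {n} {p} {q} A B r c =
  A (quotient p r) (quotient q c) ℤ.* B (remainder {m} p r) (remainder {n} q c)

-- Block matrix (M_{ij})_{i,j}, each block p × q, same index convention
block : ∀ {m n p q} → (Fin m → Fin n → Mat p q) → Mat (m ℕ.* p) (n ℕ.* q)
block {m} {n} {p} {q} M r c =
  M (quotient p r) (quotient q c) (remainder {m} p r) (remainder {n} q c)

matPow : ∀ {n} → Mat n n → ℕ → Mat n n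
matPow {n} A zero    = I n
matPow {n} A (suc k) = A *M matPow A k

r : ∀ p → Mat p p
r (suc k) i j = δ j ((toℕ i ℕ.+ 1) mod (suc k))

φ : ∀ {ns} → Grp ns → Mat (order ns) (order ns)
φ {[]}     tt      = I 1
φ {n ∷ ns} (a , x) = matPow (r n) (toℕ a) ⊗ φ x

Cmat : ∀ {ns} {N} → (Fin N → Fin N → Grp ns) → Fin N →
       Mat (N ℕ.* order ns) (N ℕ.* order ns)
Cmat H k = block (λ i j → φ ((⊖ H k i) ⊕ H k j))

-- Write φ(x) as the permutation matrix of the translation y ↦ y + x of G,
-- so that the ((i,a),(j,b)) entry of C_k is [b = a − h_ki + h_kj].  An
-- entry of C_k C_k'ᵀ is then Σ_l [a − h_ki + h_kl = b − h_k'j + h_k'l]: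
-- for k = k' the summand does not depend on l, and for k ≠ k' it counts
-- the l with h_kl − h_k'l equal to a fixed element, which is λ because H is
-- a GH(g,λ).  Likewise an off-diagonal block entry of Σ_k C_k counts the k
-- with h_ki − h_kj = a − b, so (i) needs the columns of H to be balanced as
-- well, i.e. that Hᵀ is again a GH(g,λ).
--
-- That is a variance argument.  Let c_ij(x) be the number of k with
-- h_ki − h_kj = x; then Σ_x c_ij(x) = N = gλ and Σ_x c_ij(x)² is the number
-- of pairs (k,k') with equal differences.  Summed over all (i,j), these
-- collision counts regroup into the same counts for the rows, which are
-- known: N² for k = k' and gλ² = Nλ otherwise.  But 0 ≤ Σ_x (c_ij(x) − λ)²
-- = Σ_x c_ij(x)² − Nλ for i ≠ j, so every term is forced to its lower
-- bound, the variance vanishes, and c_ij ≡ λ.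

module Submission where

open import Defs
open import Algebra.Bundles using (AbelianGroup)
open import Algebra.Consequences.Propositional using (comm∧idˡ⇒id; comm∧invˡ⇒inv)
open import Algebra.Core using (Op₁; Op₂)
import Algebra.Properties.AbelianGroup
import Algebra.Solver.CommutativeMonoid
open import Algebra.Structures using (IsAbelianGroup)
open import Data.Bool using (Bool; true; false; if_then_else_; _∧_)
open import Data.Fin as Fin using (Fin; zero; suc; toℕ; _↑ˡ_; _↑ʳ_; combine; quotient; remainder; remQuot)
open import Data.Fin.Properties
  using (remQuot-combine; combine-remQuot; toℕ-injective; toℕ-fromℕ<; toℕ<n) renaming (_≟_ to _≟F_)
open import Data.Integer as ℤ using (ℤ; +_; _+_; _*_; -_; _-_; _≤_)
import Data.Integer.Properties as ℤP
open import Data.Integer.Tactic.RingSolver using (solve-∀)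
open import Data.List using (List; []; _∷_)
open import Data.List.Relation.Unary.All using (All; []; _∷_)
open import Data.Nat as ℕ using (ℕ; NonZero)
import Data.Nat.Properties as ℕP
open import Data.Nat.DivMod using (_mod_; _%_; %-distribˡ-+; m%n<n; m%n%n≡m%n; m<n⇒m%n≡m; n%n≡0)
open import Data.Product using (_×_; _,_; uncurry)
open import Data.Product.Properties using (,-injective)
open import Data.Sum using ([_,_]′; reduce)
open import Data.Unit using (tt)
open import Function using (_∘_; flip; _⇔_; mk⇔; _↔_; mk↔ₛ′; Inverse)
open import Level using (0ℓ)
open import Relation.Binary using (DecidableEquality)
open import Relation.Binary.PropositionalEquality hiding (J; [_])
open import Relation.Nullary using (Dec; yes; no; does; ¬_; _×-dec_; map′; toSum; contradiction)
open import Relation.Nullary.Decidable using (does-⇔)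
open ≡-Reasoning

open import Algebra.Properties.Semiring.Sum ℤP.+-*-semiring
  using (sum; sum-syntax; sum-cong-≗; ∑-comm; ∑-distrib-+; *-distribˡ-sum; *-distribʳ-sum)

-- Iverson brackets and finite sums

-- On Fin, Defs.δ i j is definitionally ⟦ i ≟ j ⟧.
⟦_⟧ : ∀ {a} {P : Set a} → Dec P → ℤ
⟦ P? ⟧ = if does P? then + 1 else + 0

⟦⟧-yes : ∀ {a} {P : Set a} (P? : Dec P) → P → ⟦ P? ⟧ ≡ + 1
⟦⟧-yes (yes _) _ = refl
⟦⟧-yes (no ¬p) p = contradiction p ¬p

⟦⟧-no : ∀ {a} {P : Set a} (P? : Dec P) → ¬ P → ⟦ P? ⟧ ≡ + 0
⟦⟧-no (yes p) ¬p = contradiction p ¬p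
⟦⟧-no (no _) _ = refl

⟦⟧-cong : ∀ {a b} {P : Set a} {Q : Set b} (P? : Dec P) (Q? : Dec Q) → P ⇔ Q → ⟦ P? ⟧ ≡ ⟦ Q? ⟧
⟦⟧-cong P? Q? P⇔Q = cong (λ b → if b then + 1 else + 0) (does-⇔ P⇔Q P? Q?)

sumFin≡sum : ∀ {n} (f : Fin n → ℤ) → sumFin f ≡ sum f
sumFin≡sum {ℕ.zero}  f = refl
sumFin≡sum {ℕ.suc n} f = cong (_+_ (f zero)) (sumFin≡sum (λ i → f (suc i)))

∑-const : ∀ n c → ∑[ i < n ] c ≡ + n * c
∑-const ℕ.zero    c = refl
∑-const (ℕ.suc n) c = begin
  c + ∑[ i < n ] c    ≡⟨ cong₂ _+_ (sym (ℤP.*-identityˡ c)) (∑-const n c) ⟩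
  + 1 * c + + n * c   ≡⟨ ℤP.*-distribʳ-+ c (+ 1) (+ n) ⟨
  + ℕ.suc n * c       ∎

∑-δ : ∀ {n} (p : Fin n) (f : Fin n → ℤ) → ∑[ i < n ] (δ i p * f i) ≡ f p
∑-δ {ℕ.suc n} zero f = begin
  + 1 * f zero + ∑[ i < n ] (+ 0 * f (suc i)) ≡⟨ cong₂ _+_ (ℤP.*-identityˡ (f zero)) (∑-const n (+ 0)) ⟩
  f zero + + n * + 0                          ≡⟨ cong (_+_ (f zero)) (ℤP.*-zeroʳ (+ n)) ⟩
  f zero + + 0                                ≡⟨ ℤP.+-identityʳ (f zero) ⟩
  f zero                                      ∎
∑-δ {ℕ.suc n} (suc p) f = trans (ℤP.+-identityˡ _) (∑-δ p (λ i → f (suc i)))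

∑-++ : ∀ m n (f : Fin (m ℕ.+ n) → ℤ) → sum f ≡ ∑[ i < m ] f (i ↑ˡ n) + ∑[ j < n ] f (m ↑ʳ j)
∑-++ ℕ.zero    n f = sym (ℤP.+-identityˡ _)
∑-++ (ℕ.suc m) n f = trans (cong (_+_ (f zero)) (∑-++ m n (λ i → f (suc i)))) (sym (ℤP.+-assoc (f zero) _ _))

∑-combine : ∀ m n (f : Fin (m ℕ.* n) → ℤ) → sum f ≡ ∑[ i < m ] ∑[ j < n ] f (combine i j)
∑-combine ℕ.zero    n f = refl
∑-combine (ℕ.suc m) n f =
  trans (∑-++ n (m ℕ.* n) f) (cong (_+_ (sum (λ j → f (j ↑ˡ m ℕ.* n)))) (∑-combine m n (λ r → f (n ↑ʳ r))))

∑-count : ∀ {n} (P : Fin n → Bool) → ∑[ i < n ] (if P i then + 1 else + 0) ≡ + count P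
∑-count {ℕ.zero}  P = refl
∑-count {ℕ.suc n} P with P zero
... | true  = cong (_+_ (+ 1)) (∑-count (λ i → P (suc i)))
... | false = trans (ℤP.+-identityˡ _) (∑-count (λ i → P (suc i)))

∑-distrib-- : ∀ {n} (f h : Fin n → ℤ) → ∑[ i < n ] (f i - h i) ≡ ∑[ i < n ] f i - ∑[ i < n ] h i
∑-distrib-- {ℕ.zero}  f h = refl
∑-distrib-- {ℕ.suc n} f h = begin
  (f zero - h zero) + ∑[ i < n ] (f (suc i) - h (suc i))
    ≡⟨ cong (_+_ (f zero - h zero)) (∑-distrib-- (f ∘ suc) (h ∘ suc)) ⟩
  (f zero - h zero) + (∑[ i < n ] f (suc i) - ∑[ i < n ] h (suc i))
    ≡⟨ regroup (f zero) (h zero) _ _ ⟩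
  (f zero + ∑[ i < n ] f (suc i)) - (h zero + ∑[ i < n ] h (suc i)) ∎
  where
  regroup : ∀ a b c d → (a - b) + (c - d) ≡ (a + c) - (b + d)
  regroup = solve-∀

∑-comm₄ : ∀ {a b c d} (f : Fin a → Fin b → Fin c → Fin d → ℤ) →
  ∑[ i < a ] ∑[ j < b ] ∑[ k < c ] ∑[ l < d ] f i j k l ≡ ∑[ k < c ] ∑[ l < d ] ∑[ i < a ] ∑[ j < b ] f i j k l
∑-comm₄ {a} {b} {c} {d} f = begin
  ∑[ i < a ] ∑[ j < b ] ∑[ k < c ] ∑[ l < d ] f i j k l   ≡⟨ sum-cong-≗ (λ i → ∑-comm (λ j k → ∑[ l < d ] f i j k l)) ⟩
  ∑[ i < a ] ∑[ k < c ] ∑[ j < b ] ∑[ l < d ] f i j k l   ≡⟨ ∑-comm (λ i k → ∑[ j < b ] ∑[ l < d ] f i j k l) ⟩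
  ∑[ k < c ] ∑[ i < a ] ∑[ j < b ] ∑[ l < d ] f i j k l   ≡⟨ sum-cong-≗ (λ k → sum-cong-≗ (λ i → ∑-comm (λ j l → f i j k l))) ⟩
  ∑[ k < c ] ∑[ i < a ] ∑[ l < d ] ∑[ j < b ] f i j k l   ≡⟨ sum-cong-≗ (λ k → ∑-comm (λ i l → ∑[ j < b ] f i j k l)) ⟩
  ∑[ k < c ] ∑[ l < d ] ∑[ i < a ] ∑[ j < b ] f i j k l   ∎

+-nonneg≡0ˡ : ∀ {i j} → + 0 ≤ i → + 0 ≤ j → i + j ≡ + 0 → i ≡ + 0
+-nonneg≡0ˡ {+ m} (ℤ.+≤+ _) (ℤ.+≤+ _) i+j≡0 = cong +_ (ℕP.m+n≡0⇒m≡0 m (ℤP.+-injective i+j≡0))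

square-nonneg : ∀ i → + 0 ≤ i * i
square-nonneg (+ n)      = subst (+ 0 ≤_) (ℤP.pos-* n n) (ℤ.+≤+ ℕ.z≤n)
square-nonneg ℤ.-[1+ n ] = ℤ.+≤+ ℕ.z≤n

square≡0 : ∀ i → i * i ≡ + 0 → i ≡ + 0
square≡0 i i*i≡0 = reduce (ℤP.i*j≡0⇒i≡0∨j≡0 i i*i≡0)

∑-nonneg : ∀ {n} (f : Fin n → ℤ) → (∀ i → + 0 ≤ f i) → + 0 ≤ sum f
∑-nonneg {ℕ.zero}  f f≥0 = ℤP.≤-refl
∑-nonneg {ℕ.suc n} f f≥0 = ℤP.+-mono-≤ (f≥0 zero) (∑-nonneg (λ i → f (suc i)) (λ i → f≥0 (suc i)))

∑-nonneg≡0 : ∀ {n} (f : Fin n → ℤ) → (∀ i → + 0 ≤ f i) → sum f ≡ + 0 → ∀ i → f i ≡ + 0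
∑-nonneg≡0 {ℕ.suc n} f f≥0 ∑f≡0 zero    = +-nonneg≡0ˡ (f≥0 zero) (∑-nonneg _ (λ i → f≥0 (suc i))) ∑f≡0
∑-nonneg≡0 {ℕ.suc n} f f≥0 ∑f≡0 (suc i) = ∑-nonneg≡0 (λ i → f (suc i)) (λ i → f≥0 (suc i))
  (+-nonneg≡0ˡ (∑-nonneg _ (λ i → f≥0 (suc i))) (f≥0 zero) (trans (ℤP.+-comm _ (f zero)) ∑f≡0)) i

-- The group ℤ_{n₁} ⊕ ⋯ ⊕ ℤ_{n_s}

module _ {k : ℕ} where

  private
    n = ℕ.suc k

  toℕ-mod : (a : Fin n) → toℕ a mod n ≡ a
  toℕ-mod a = toℕ-injective (trans (toℕ-fromℕ< _) (m<n⇒m%n≡m (toℕ<n a)))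

  toℕ-mod-+ : ∀ m m' → (toℕ (m mod n) ℕ.+ m') mod n ≡ (m ℕ.+ m') mod n
  toℕ-mod-+ m m' = toℕ-injective (begin
    toℕ ((toℕ (m mod n) ℕ.+ m') mod n)      ≡⟨ toℕ-fromℕ< _ ⟩
    (toℕ (m mod n) ℕ.+ m') % n              ≡⟨ cong (λ x → (x ℕ.+ m') % n) (toℕ-fromℕ< (m%n<n m n)) ⟩
    (m % n ℕ.+ m') % n                      ≡⟨ %-distribˡ-+ (m % n) m' n ⟩
    (m % n % n ℕ.+ m' % n) % n              ≡⟨ cong (λ x → (x ℕ.+ m' % n) % n) (m%n%n≡m%n m n) ⟩
    (m % n ℕ.+ m' % n) % n                  ≡⟨ %-distribˡ-+ m m' n ⟨
    (m ℕ.+ m') % n                          ≡⟨ toℕ-fromℕ< _ ⟨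
    toℕ ((m ℕ.+ m') mod n)                  ∎)

  addZ-mod : ∀ m m' → addZ (m mod n) (m' mod n) ≡ (m ℕ.+ m') mod n
  addZ-mod m m' = toℕ-injective (begin
    toℕ (addZ (m mod n) (m' mod n))              ≡⟨ toℕ-fromℕ< _ ⟩
    (toℕ (m mod n) ℕ.+ toℕ (m' mod n)) % n
      ≡⟨ cong₂ (λ x y → (x ℕ.+ y) % n) (toℕ-fromℕ< (m%n<n m n)) (toℕ-fromℕ< (m%n<n m' n)) ⟩
    (m % n ℕ.+ m' % n) % n                       ≡⟨ %-distribˡ-+ m m' n ⟨
    (m ℕ.+ m') % n                               ≡⟨ toℕ-fromℕ< _ ⟨
    toℕ ((m ℕ.+ m') mod n)                       ∎)

  addZ-assoc : (a b c : Fin n) → addZ (addZ a b) c ≡ addZ a (addZ b c)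
  addZ-assoc a b c = begin
    addZ (addZ a b) c                                      ≡⟨ cong (addZ (addZ a b)) (toℕ-mod c) ⟨
    addZ ((toℕ a ℕ.+ toℕ b) mod n) (toℕ c mod n)           ≡⟨ addZ-mod (toℕ a ℕ.+ toℕ b) (toℕ c) ⟩
    (toℕ a ℕ.+ toℕ b ℕ.+ toℕ c) mod n                      ≡⟨ cong (_mod n) (ℕP.+-assoc (toℕ a) (toℕ b) (toℕ c)) ⟩
    (toℕ a ℕ.+ (toℕ b ℕ.+ toℕ c)) mod n                    ≡⟨ addZ-mod (toℕ a) (toℕ b ℕ.+ toℕ c) ⟨
    addZ (toℕ a mod n) ((toℕ b ℕ.+ toℕ c) mod n)           ≡⟨ cong (λ x → addZ x (addZ b c)) (toℕ-mod a) ⟩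
    addZ a (addZ b c)                                      ∎

  addZ-comm : (a b : Fin n) → addZ a b ≡ addZ b a
  addZ-comm a b = cong (_mod n) (ℕP.+-comm (toℕ a) (toℕ b))

  addZ-identityˡ : (a : Fin n) → addZ zero a ≡ a
  addZ-identityˡ = toℕ-mod

  addZ-inverseˡ : (a : Fin n) → addZ (negZ a) a ≡ zero
  addZ-inverseˡ a = begin
    addZ (negZ a) a                       ≡⟨ cong (addZ (negZ a)) (toℕ-mod a) ⟨
    addZ (negZ a) (toℕ a mod n)           ≡⟨ addZ-mod (n ℕ.∸ toℕ a) (toℕ a) ⟩
    (n ℕ.∸ toℕ a ℕ.+ toℕ a) mod n         ≡⟨ cong (_mod n) (ℕP.m∸n+n≡m (ℕP.<⇒≤ (toℕ<n a))) ⟩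
    n mod n                               ≡⟨ toℕ-injective (trans (toℕ-fromℕ< _) (n%n≡0 n)) ⟩
    zero                                  ∎

-- Fin 0 is empty, so the identity element needs every modulus to be non-zero.
0G : ∀ {ns} → All NonZero ns → Grp ns
0G []                         = tt
0G {ℕ.suc k ∷ _} (_ ∷ nonZero) = zero , 0G nonZero

⊕-assoc : ∀ {ns} (x y z : Grp ns) → (x ⊕ y) ⊕ z ≡ x ⊕ (y ⊕ z)
⊕-assoc {[]}     _       _       _       = refl
⊕-assoc {ℕ.suc _ ∷ _} (a , x) (b , y) (c , z) = cong₂ _,_ (addZ-assoc a b c) (⊕-assoc x y z)

⊕-comm : ∀ {ns} (x y : Grp ns) → x ⊕ y ≡ y ⊕ x
⊕-comm {[]}     _       _       = refl
⊕-comm {ℕ.suc _ ∷ _} (a , x) (b , y) = cong₂ _,_ (addZ-comm a b) (⊕-comm x y)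

⊕-identityˡ : ∀ {ns} (nonZero : All NonZero ns) (x : Grp ns) → 0G nonZero ⊕ x ≡ x
⊕-identityˡ []                          _       = refl
⊕-identityˡ {ℕ.suc k ∷ _} (_ ∷ nonZero) (a , x) = cong₂ _,_ (addZ-identityˡ a) (⊕-identityˡ nonZero x)

⊕-inverseˡ : ∀ {ns} (nonZero : All NonZero ns) (x : Grp ns) → (⊖ x) ⊕ x ≡ 0G nonZero
⊕-inverseˡ []                          _       = refl
⊕-inverseˡ {ℕ.suc k ∷ _} (_ ∷ nonZero) (a , x) = cong₂ _,_ (addZ-inverseˡ a) (⊕-inverseˡ nonZero x)

Grp-isAbelianGroup : ∀ {ns} (nonZero : All NonZero ns) → IsAbelianGroup _≡_ _⊕_ (0G nonZero) ⊖_
Grp-isAbelianGroup nonZero = record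
  { isGroup = record
    { isMonoid = record
      { isSemigroup = record { isMagma = record { isEquivalence = isEquivalence ; ∙-cong = cong₂ _⊕_ } ; assoc = ⊕-assoc }
      ; identity = comm∧idˡ⇒id ⊕-comm (⊕-identityˡ nonZero)
      }
    ; inverse = comm∧invˡ⇒inv ⊕-comm (⊕-inverseˡ nonZero)
    ; ⁻¹-cong = cong ⊖_
    }
  ; comm = ⊕-comm
  }

infix 4 _≟G_
_≟G_ : ∀ {ns} → DecidableEquality (Grp ns)
_≟G_ {[]}    tt      tt      = yes refl
_≟G_ {_ ∷ _} (a , x) (b , y) = map′ (uncurry (cong₂ _,_)) ,-injective (a ≟F b ×-dec x ≟G y)

eqG≡does : ∀ {ns} (x y : Grp ns) → eqG x y ≡ does (x ≟G y)
eqG≡does {[]}    _       _       = refl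
eqG≡does {_ ∷ _} (a , x) (b , y) = cong (does (a ≟F b) ∧_) (eqG≡does x y)

⟦,≟,⟧ : ∀ {n ns} (a b : Fin n) (x y : Grp ns) → ⟦ (a , x) ≟G (b , y) ⟧ ≡ δ a b * ⟦ x ≟G y ⟧
⟦,≟,⟧ a b x y with does (a ≟F b)
... | true  = sym (ℤP.*-identityˡ ⟦ x ≟G y ⟧)
... | false = refl

decode : ∀ ns → Fin (order ns) → Grp ns
decode []       _ = tt
decode (n ∷ ns) u = quotient (order ns) u , decode ns (remainder {n} (order ns) u)

encode : ∀ {ns} → Grp ns → Fin (order ns)
encode {[]}    tt      = zero
encode {_ ∷ _} (a , x) = combine a (encode x)

decode-encode : ∀ {ns} (x : Grp ns) → decode ns (encode x) ≡ x
decode-encode {[]}     tt      = refl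
decode-encode {n ∷ ns} (a , x) = begin
  decode (n ∷ ns) (combine a (encode x))  ≡⟨ cong (λ (b , u) → b , decode ns u) (remQuot-combine a (encode x)) ⟩
  a , decode ns (encode x)                ≡⟨ cong (a ,_) (decode-encode x) ⟩
  a , x                                   ∎

encode-decode : ∀ {ns} (u : Fin (order ns)) → encode (decode ns u) ≡ u
encode-decode {[]}     zero = refl
encode-decode {n ∷ ns} u    = begin
  combine {n} (quotient (order ns) u) (encode (decode ns (remainder {n} (order ns) u)))
    ≡⟨ cong (combine {n} (quotient (order ns) u)) (encode-decode {ns} (remainder {n} (order ns) u)) ⟩
  uncurry combine (remQuot {n} (order ns) u)
    ≡⟨ combine-remQuot {n} (order ns) u ⟩
  u ∎

Fin↔Grp : ∀ ns → Fin (order ns) ↔ Grp ns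
Fin↔Grp ns = mk↔ₛ′ (decode ns) encode decode-encode (encode-decode {ns})

-- The permutation representation

δ-sym : ∀ {n} (i j : Fin n) → δ i j ≡ δ j i
δ-sym i j = ⟦⟧-cong (i ≟F j) (j ≟F i) (mk⇔ sym sym)

matPow-r-entry : ∀ {k} t (i j : Fin (ℕ.suc k)) → matPow (r (ℕ.suc k)) t i j ≡ δ j ((toℕ i ℕ.+ t) mod ℕ.suc k)
matPow-r-entry ℕ.zero i j = begin
  δ i j                                   ≡⟨ δ-sym i j ⟩
  δ j i                                   ≡⟨ cong (δ j) (toℕ-mod i) ⟨
  δ j (toℕ i mod _)                       ≡⟨ cong (λ m → δ j (m mod _)) (ℕP.+-identityʳ (toℕ i)) ⟨
  δ j ((toℕ i ℕ.+ 0) mod _)               ∎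
matPow-r-entry {k} (ℕ.suc t) i j = begin
  sumFin (λ c → δ c i+1 * matPow (r (ℕ.suc k)) t c j)           ≡⟨ sumFin≡sum (λ c → δ c i+1 * matPow (r (ℕ.suc k)) t c j) ⟩
  ∑[ c < ℕ.suc k ] (δ c i+1 * matPow (r (ℕ.suc k)) t c j)       ≡⟨ ∑-δ i+1 (λ c → matPow (r (ℕ.suc k)) t c j) ⟩
  matPow (r (ℕ.suc k)) t i+1 j                                  ≡⟨ matPow-r-entry t i+1 j ⟩
  δ j ((toℕ i+1 ℕ.+ t) mod ℕ.suc k)                             ≡⟨ cong (δ j) (toℕ-mod-+ (toℕ i ℕ.+ 1) t) ⟩
  δ j ((toℕ i ℕ.+ 1 ℕ.+ t) mod ℕ.suc k)                         ≡⟨ cong (λ m → δ j (m mod _)) (ℕP.+-assoc (toℕ i) 1 t) ⟩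
  δ j ((toℕ i ℕ.+ ℕ.suc t) mod ℕ.suc k)                         ∎
  where
  i+1 = (toℕ i ℕ.+ 1) mod ℕ.suc k

φ-translation : ∀ {ns} (x : Grp ns) (u v : Fin (order ns)) → φ x u v ≡ ⟦ decode ns v ≟G (decode ns u ⊕ x) ⟧
φ-translation {[]}            tt      zero zero = refl
φ-translation {ℕ.suc k ∷ ns} (a , x) u    v    = begin
  matPow (r (ℕ.suc k)) (toℕ a) (quotient _ u) (quotient _ v) * φ x (remainder _ u) (remainder _ v)
    ≡⟨ cong₂ _*_ (matPow-r-entry (toℕ a) (quotient _ u) (quotient _ v)) (φ-translation x (remainder _ u) (remainder _ v)) ⟩
  δ (quotient _ v) (addZ (quotient _ u) a) * ⟦ decode ns (remainder _ v) ≟G (decode ns (remainder _ u) ⊕ x) ⟧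
    ≡⟨ ⟦,≟,⟧ (quotient _ v) (addZ (quotient _ u) a) (decode ns (remainder _ v)) (decode ns (remainder _ u) ⊕ x) ⟨
  ⟦ decode (ℕ.suc k ∷ ns) v ≟G (decode (ℕ.suc k ∷ ns) u ⊕ (a , x)) ⟧ ∎

-- Generalized Hadamard matrices over a finite abelian group

module FiniteAbelianGroup
  {G : Set} {mul : Op₂ G} {e : G} {inv : Op₁ G}
  (isAbelianGroup : IsAbelianGroup _≡_ mul e inv)
  (decEq : DecidableEquality G)
  {g : ℕ} (enumeration : Fin g ↔ G)
  where

  infix 4 _≟_
  _≟_ : DecidableEquality G
  _≟_ = decEq

  𝔾 : AbelianGroup 0ℓ 0ℓ
  𝔾 = record { isAbelianGroup = isAbelianGroup }

  open AbelianGroup 𝔾 using (_∙_; ε; _⁻¹; inverseʳ; commutativeMonoid)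
  open Algebra.Properties.AbelianGroup 𝔾 using (x∙y⁻¹≈ε⇒x≈y; x≈y⇒x∙y⁻¹≈ε; ∙-cancelʳ; ⁻¹-anti-homo‿-; ⁻¹-∙-comm)
  open Algebra.Solver.CommutativeMonoid commutativeMonoid using (solve; _⊜_) renaming (_⊕_ to _⊙_)
  open Inverse enumeration using (to; from; strictlyInverseˡ; strictlyInverseʳ)

  ⟦≟⟧-sym : ∀ x y → ⟦ x ≟ y ⟧ ≡ ⟦ y ≟ x ⟧
  ⟦≟⟧-sym x y = ⟦⟧-cong (x ≟ y) (y ≟ x) (mk⇔ sym sym)

  ⟦≟⟧-by-difference : ∀ x y x' y' → x ∙ y ⁻¹ ≡ x' ∙ y' ⁻¹ → ⟦ x ≟ y ⟧ ≡ ⟦ x' ≟ y' ⟧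
  ⟦≟⟧-by-difference x y x' y' eq = ⟦⟧-cong (x ≟ y) (x' ≟ y') (mk⇔
    (λ x≡y → x∙y⁻¹≈ε⇒x≈y x' y' (trans (sym eq) (x≈y⇒x∙y⁻¹≈ε x≡y)))
    (λ x'≡y' → x∙y⁻¹≈ε⇒x≈y x y (trans eq (x≈y⇒x∙y⁻¹≈ε x'≡y'))))

  ⟦≟⟧-translate : ∀ x y t → ⟦ x ∙ t ≟ y ∙ t ⟧ ≡ ⟦ x ≟ y ⟧
  ⟦≟⟧-translate x y t = ⟦⟧-cong (x ∙ t ≟ y ∙ t) (x ≟ y) (mk⇔ (∙-cancelʳ t x y) (cong (_∙ t)))

  ⟦≟⟧-cross : ∀ x y z w → ⟦ x ∙ y ⁻¹ ≟ z ∙ w ⁻¹ ⟧ ≡ ⟦ x ∙ z ⁻¹ ≟ y ∙ w ⁻¹ ⟧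
  ⟦≟⟧-cross x y z w = ⟦≟⟧-by-difference _ _ _ _ (begin
    (x ∙ y ⁻¹) ∙ (z ∙ w ⁻¹) ⁻¹   ≡⟨ cong ((x ∙ y ⁻¹) ∙_) (⁻¹-anti-homo‿- z w) ⟩
    (x ∙ y ⁻¹) ∙ (w ∙ z ⁻¹)      ≡⟨ solve 4 (λ x y' w z' → (x ⊙ y') ⊙ (w ⊙ z') ⊜ (x ⊙ z') ⊙ (w ⊙ y')) refl x (y ⁻¹) w (z ⁻¹) ⟩
    (x ∙ z ⁻¹) ∙ (w ∙ y ⁻¹)      ≡⟨ cong ((x ∙ z ⁻¹) ∙_) (⁻¹-anti-homo‿- y w) ⟨
    (x ∙ z ⁻¹) ∙ (y ∙ w ⁻¹) ⁻¹   ∎)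

  ⟦≟∙⟧-difference : ∀ a b p q → ⟦ b ≟ a ∙ (p ⁻¹ ∙ q) ⟧ ≡ ⟦ a ∙ p ⁻¹ ≟ b ∙ q ⁻¹ ⟧
  ⟦≟∙⟧-difference a b p q = begin
    ⟦ b ≟ a ∙ (p ⁻¹ ∙ q) ⟧   ≡⟨ ⟦≟⟧-sym b _ ⟩
    ⟦ a ∙ (p ⁻¹ ∙ q) ≟ b ⟧   ≡⟨ ⟦≟⟧-by-difference _ _ _ _ (begin
        (a ∙ (p ⁻¹ ∙ q)) ∙ b ⁻¹       ≡⟨ solve 4 (λ a p' q b' → (a ⊙ (p' ⊙ q)) ⊙ b' ⊜ (a ⊙ p') ⊙ (q ⊙ b')) refl a (p ⁻¹) q (b ⁻¹) ⟩
        (a ∙ p ⁻¹) ∙ (q ∙ b ⁻¹)       ≡⟨ cong ((a ∙ p ⁻¹) ∙_) (⁻¹-anti-homo‿- b q) ⟨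
        (a ∙ p ⁻¹) ∙ (b ∙ q ⁻¹) ⁻¹    ∎) ⟩
    ⟦ a ∙ p ⁻¹ ≟ b ∙ q ⁻¹ ⟧  ∎

  ⟦∙≟∙⟧ : ∀ x y z w → ⟦ x ∙ y ≟ z ∙ w ⟧ ≡ ⟦ y ∙ w ⁻¹ ≟ z ∙ x ⁻¹ ⟧
  ⟦∙≟∙⟧ x y z w = ⟦≟⟧-by-difference _ _ _ _ (begin
    (x ∙ y) ∙ (z ∙ w) ⁻¹          ≡⟨ cong ((x ∙ y) ∙_) (⁻¹-∙-comm z w) ⟨
    (x ∙ y) ∙ (z ⁻¹ ∙ w ⁻¹)       ≡⟨ solve 4 (λ x y z' w' → (x ⊙ y) ⊙ (z' ⊙ w') ⊜ (y ⊙ w') ⊙ (x ⊙ z')) refl x y (z ⁻¹) (w ⁻¹) ⟩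
    (y ∙ w ⁻¹) ∙ (x ∙ z ⁻¹)       ≡⟨ cong ((y ∙ w ⁻¹) ∙_) (⁻¹-anti-homo‿- z x) ⟨
    (y ∙ w ⁻¹) ∙ (z ∙ x ⁻¹) ⁻¹    ∎)

  ⟦to≟⟧ : ∀ i x → ⟦ to i ≟ x ⟧ ≡ δ i (from x)
  ⟦to≟⟧ i x = ⟦⟧-cong (to i ≟ x) (i ≟F from x) (mk⇔
    (λ toi≡x → trans (sym (strictlyInverseʳ i)) (cong from toi≡x))
    (λ i≡fromx → trans (cong to i≡fromx) (strictlyInverseˡ x)))

  ⟦to≟to⟧ : ∀ i j → ⟦ to i ≟ to j ⟧ ≡ δ i j
  ⟦to≟to⟧ i j = trans (⟦to≟⟧ i (to j)) (cong (δ i) (strictlyInverseʳ j))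

  ∑ᴳ : (G → ℤ) → ℤ
  ∑ᴳ f = ∑[ i < g ] f (to i)

  ∑ᴳ-⟦≟⟧-* : ∀ x (f : G → ℤ) → ∑ᴳ (λ y → ⟦ y ≟ x ⟧ * f y) ≡ f x
  ∑ᴳ-⟦≟⟧-* x f = begin
    ∑[ i < g ] (⟦ to i ≟ x ⟧ * f (to i))    ≡⟨ sum-cong-≗ (λ i → cong (_* f (to i)) (⟦to≟⟧ i x)) ⟩
    ∑[ i < g ] (δ i (from x) * f (to i))    ≡⟨ ∑-δ (from x) (f ∘ to) ⟩
    f (to (from x))                         ≡⟨ cong f (strictlyInverseˡ x) ⟩
    f x                                     ∎

  ∑ᴳ-⟦≟⟧ : ∀ x → ∑ᴳ (λ y → ⟦ y ≟ x ⟧) ≡ + 1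
  ∑ᴳ-⟦≟⟧ x = trans (sum-cong-≗ (λ i → sym (ℤP.*-identityʳ ⟦ to i ≟ x ⟧))) (∑ᴳ-⟦≟⟧-* x (λ _ → + 1))

  multiplicity : ∀ {N} → (Fin N → G) → G → ℤ
  multiplicity {N} u x = ∑[ k < N ] ⟦ u k ≟ x ⟧

  collisions : ∀ {N} → (Fin N → G) → ℤ
  collisions {N} u = ∑[ k < N ] ∑[ k' < N ] ⟦ u k ≟ u k' ⟧

  ∑ᴳ-multiplicity : ∀ {N} (u : Fin N → G) → ∑ᴳ (multiplicity u) ≡ + N
  ∑ᴳ-multiplicity {N} u = begin
    ∑[ i < g ] ∑[ k < N ] ⟦ u k ≟ to i ⟧   ≡⟨ ∑-comm (λ i k → ⟦ u k ≟ to i ⟧) ⟩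
    ∑[ k < N ] ∑ᴳ (λ y → ⟦ u k ≟ y ⟧)       ≡⟨ sum-cong-≗ (λ k → trans (sum-cong-≗ (λ i → ⟦≟⟧-sym (u k) (to i))) (∑ᴳ-⟦≟⟧ (u k))) ⟩
    ∑[ k < N ] (+ 1)                           ≡⟨ ∑-const N (+ 1) ⟩
    + N * + 1                                ≡⟨ ℤP.*-identityʳ (+ N) ⟩
    + N                                      ∎

  ∑ᴳ-multiplicity² : ∀ {N} (u : Fin N → G) →
    ∑ᴳ (λ x → multiplicity u x * multiplicity u x) ≡ collisions u
  ∑ᴳ-multiplicity² {N} u = begin
    ∑[ i < g ] (m (to i) * m (to i))
      ≡⟨ sum-cong-≗ (λ i → product (to i)) ⟩
    ∑[ i < g ] ∑[ k < N ] ∑[ k' < N ] (⟦ to i ≟ u k ⟧ * ⟦ to i ≟ u k' ⟧)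
      ≡⟨ ∑-comm (λ i k → ∑[ k' < N ] (⟦ to i ≟ u k ⟧ * ⟦ to i ≟ u k' ⟧)) ⟩
    ∑[ k < N ] ∑[ i < g ] ∑[ k' < N ] (⟦ to i ≟ u k ⟧ * ⟦ to i ≟ u k' ⟧)
      ≡⟨ sum-cong-≗ (λ k → ∑-comm (λ i k' → ⟦ to i ≟ u k ⟧ * ⟦ to i ≟ u k' ⟧)) ⟩
    ∑[ k < N ] ∑[ k' < N ] ∑ᴳ (λ y → ⟦ y ≟ u k ⟧ * ⟦ y ≟ u k' ⟧)
      ≡⟨ sum-cong-≗ (λ k → sum-cong-≗ (λ k' → ∑ᴳ-⟦≟⟧-* (u k) (λ y → ⟦ y ≟ u k' ⟧))) ⟩
    collisions u ∎
    where
    m = multiplicity u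
    product : ∀ y → m y * m y ≡ ∑[ k < N ] ∑[ k' < N ] (⟦ y ≟ u k ⟧ * ⟦ y ≟ u k' ⟧)
    product y = begin
      m y * m y
        ≡⟨ *-distribʳ-sum (m y) (λ k → ⟦ u k ≟ y ⟧) ⟩
      ∑[ k < N ] (⟦ u k ≟ y ⟧ * m y)
        ≡⟨ sum-cong-≗ (λ k → *-distribˡ-sum ⟦ u k ≟ y ⟧ (λ k' → ⟦ u k' ≟ y ⟧)) ⟩
      ∑[ k < N ] ∑[ k' < N ] (⟦ u k ≟ y ⟧ * ⟦ u k' ≟ y ⟧)
        ≡⟨ sum-cong-≗ (λ k → sum-cong-≗ (λ k' → cong₂ _*_ (⟦≟⟧-sym (u k) y) (⟦≟⟧-sym (u k') y))) ⟩
      ∑[ k < N ] ∑[ k' < N ] (⟦ y ≟ u k ⟧ * ⟦ y ≟ u k' ⟧) ∎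

  collisions-const : ∀ {N} (u : Fin N → G) x → (∀ k → u k ≡ x) → collisions u ≡ + N * + N
  collisions-const {N} u x u≡x = begin
    collisions u            ≡⟨ sum-cong-≗ (λ k → sum-cong-≗ (λ k' → ⟦⟧-yes (u k ≟ u k') (trans (u≡x k) (sym (u≡x k'))))) ⟩
    ∑[ k < N ] ∑[ k' < N ] (+ 1)   ≡⟨ sum-cong-≗ {N} (λ _ → ∑-const N (+ 1)) ⟩
    ∑[ k < N ] (+ N * + 1)       ≡⟨ ∑-const N (+ N * + 1) ⟩
    + N * (+ N * + 1)            ≡⟨ cong (+ N *_) (ℤP.*-identityʳ (+ N)) ⟩
    + N * + N                    ∎

  ∑ᴳ-variance : ∀ (m : G → ℤ) c → ∑ᴳ m ≡ + g * c →
    ∑ᴳ (λ x → (m x - c) * (m x - c)) ≡ ∑ᴳ (λ x → m x * m x) - + g * (c * c)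
  ∑ᴳ-variance m c ∑m≡gc = begin
    ∑ᴳ (λ x → (m x - c) * (m x - c))
      ≡⟨ sum-cong-≗ (λ i → expand (m (to i)) c) ⟩
    ∑ᴳ (λ x → (m x * m x + - (c + c) * m x) + c * c)
      ≡⟨ ∑-distrib-+ (λ i → m (to i) * m (to i) + - (c + c) * m (to i)) (λ _ → c * c) ⟩
    ∑ᴳ (λ x → m x * m x + - (c + c) * m x) + ∑[ i < g ] (c * c)
      ≡⟨ cong₂ _+_ (∑-distrib-+ (λ i → m (to i) * m (to i)) (λ i → - (c + c) * m (to i))) (∑-const g (c * c)) ⟩
    (∑ᴳ (λ x → m x * m x) + ∑ᴳ (λ x → - (c + c) * m x)) + + g * (c * c)
      ≡⟨ cong (λ s → (∑ᴳ (λ x → m x * m x) + s) + + g * (c * c)) (*-distribˡ-sum (- (c + c)) (m ∘ to)) ⟨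
    (∑ᴳ (λ x → m x * m x) + - (c + c) * ∑ᴳ m) + + g * (c * c)
      ≡⟨ cong (λ s → (∑ᴳ (λ x → m x * m x) + - (c + c) * s) + + g * (c * c)) ∑m≡gc ⟩
    (∑ᴳ (λ x → m x * m x) + - (c + c) * (+ g * c)) + + g * (c * c)
      ≡⟨ collect (∑ᴳ (λ x → m x * m x)) c (+ g) ⟩
    ∑ᴳ (λ x → m x * m x) - + g * (c * c) ∎
    where
    expand : ∀ y d → (y - d) * (y - d) ≡ (y * y + - (d + d) * y) + d * d
    expand = solve-∀
    collect : ∀ s d h → (s + - (d + d) * (h * d)) + h * (d * d) ≡ s - h * (d * d)
    collect = solve-∀

  IsGeneralizedHadamard : ∀ {N} → ℕ → (Fin N → Fin N → G) → Set
  IsGeneralizedHadamard λ' H = ∀ i k → i ≢ k → ∀ x → multiplicity (λ j → H i j ∙ H k j ⁻¹) x ≡ + λ'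

  module _ {N λ' : ℕ} {H : Fin N → Fin N → G} (N≡gλ : + N ≡ + g * + λ') (isGH : IsGeneralizedHadamard λ' H) where

    private
      rowDiff colDiff : Fin N → Fin N → Fin N → G
      rowDiff k k' i = H k i ∙ H k' i ⁻¹
      colDiff i j k = H k i ∙ H k j ⁻¹

      squaredDeviation : Fin N → Fin N → G → ℤ
      squaredDeviation i j x = (multiplicity (colDiff i j) x - + λ') * (multiplicity (colDiff i j) x - + λ')

      deficiency : Fin N → Fin N → ℤ
      deficiency i j = collisions (colDiff i j) - collisions (rowDiff i j)

    collisions-rowDiff-≢ : ∀ k k' → k ≢ k' → collisions (rowDiff k k') ≡ + N * + λ'
    collisions-rowDiff-≢ k k' k≢k' = begin
      collisions (rowDiff k k')                                      ≡⟨ ∑ᴳ-multiplicity² (rowDiff k k') ⟨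
      ∑ᴳ (λ x → multiplicity (rowDiff k k') x * multiplicity (rowDiff k k') x)
        ≡⟨ sum-cong-≗ (λ i → cong₂ _*_ (isGH k k' k≢k' (to i)) (isGH k k' k≢k' (to i))) ⟩
      ∑[ i < g ] (+ λ' * + λ')                                       ≡⟨ ∑-const g (+ λ' * + λ') ⟩
      + g * (+ λ' * + λ')                                            ≡⟨ ℤP.*-assoc (+ g) (+ λ') (+ λ') ⟨
      + g * + λ' * + λ'                                              ≡⟨ cong (_* + λ') N≡gλ ⟨
      + N * + λ'                                                     ∎

    ∑ᴳ-squaredDeviation : ∀ i j → ∑ᴳ (squaredDeviation i j) ≡ collisions (colDiff i j) - + N * + λ'
    ∑ᴳ-squaredDeviation i j = begin
      ∑ᴳ (squaredDeviation i j)
        ≡⟨ ∑ᴳ-variance m (+ λ') (trans (∑ᴳ-multiplicity (colDiff i j)) N≡gλ) ⟩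
      ∑ᴳ (λ x → m x * m x) - + g * (+ λ' * + λ')
        ≡⟨ cong₂ _-_ (∑ᴳ-multiplicity² (colDiff i j))
                     (trans (sym (ℤP.*-assoc (+ g) (+ λ') (+ λ'))) (cong (_* + λ') (sym N≡gλ))) ⟩
      collisions (colDiff i j) - + N * + λ' ∎
      where
      m = multiplicity (colDiff i j)

    deficiency-nonneg : ∀ i j → + 0 ≤ deficiency i j
    deficiency-nonneg i j with i ≟F j
    ... | yes refl = ℤP.≤-reflexive (sym (trans
          (cong₂ _-_ (collisions-const (colDiff i i) ε (λ k → inverseʳ (H k i)))
                     (collisions-const (rowDiff i i) ε (λ k → inverseʳ (H i k))))
          (ℤP.+-inverseʳ (+ N * + N))))
    ... | no i≢j = subst (+ 0 ≤_)
          (trans (∑ᴳ-squaredDeviation i j) (cong (_-_ (collisions (colDiff i j))) (sym (collisions-rowDiff-≢ i j i≢j))))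
          (∑-nonneg _ (λ x → square-nonneg (multiplicity (colDiff i j) (to x) - + λ')))

    -- Both sides count the (i, j, k, k') with H k i − H k j = H k' i − H k' j.
    ∑∑-collisions-colDiff : ∑[ i < N ] ∑[ j < N ] collisions (colDiff i j) ≡ ∑[ k < N ] ∑[ k' < N ] collisions (rowDiff k k')
    ∑∑-collisions-colDiff = trans (∑-comm₄ (λ i j k k' → ⟦ colDiff i j k ≟ colDiff i j k' ⟧))
      (sum-cong-≗ (λ k → sum-cong-≗ (λ k' → sum-cong-≗ (λ i → sum-cong-≗ (λ j →
        ⟦≟⟧-cross (H k i) (H k j) (H k' i) (H k' j))))))

    deficiency≡0 : ∀ i j → deficiency i j ≡ + 0
    deficiency≡0 i j = ∑-nonneg≡0 (deficiency i) (deficiency-nonneg i)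
      (∑-nonneg≡0 (λ i → ∑[ j < N ] deficiency i j) (λ i → ∑-nonneg (deficiency i) (deficiency-nonneg i))
                  ∑∑deficiency≡0 i) j
      where
      ∑∑deficiency≡0 : ∑[ i < N ] ∑[ j < N ] deficiency i j ≡ + 0
      ∑∑deficiency≡0 = begin
        ∑[ i < N ] ∑[ j < N ] deficiency i j
          ≡⟨ sum-cong-≗ (λ i → ∑-distrib-- (λ j → collisions (colDiff i j)) (λ j → collisions (rowDiff i j))) ⟩
        ∑[ i < N ] (∑[ j < N ] collisions (colDiff i j) - ∑[ j < N ] collisions (rowDiff i j))
          ≡⟨ ∑-distrib-- (λ i → ∑[ j < N ] collisions (colDiff i j)) (λ i → ∑[ j < N ] collisions (rowDiff i j)) ⟩
        ∑∑colDiff - ∑∑rowDiff   ≡⟨ cong (_- ∑∑rowDiff) ∑∑-collisions-colDiff ⟩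
        ∑∑rowDiff - ∑∑rowDiff   ≡⟨ ℤP.+-inverseʳ ∑∑rowDiff ⟩
        + 0 ∎
        where
        ∑∑colDiff ∑∑rowDiff : ℤ
        ∑∑colDiff = ∑[ i < N ] ∑[ j < N ] collisions (colDiff i j)
        ∑∑rowDiff = ∑[ i < N ] ∑[ j < N ] collisions (rowDiff i j)

    transpose-isGeneralizedHadamard : IsGeneralizedHadamard λ' (flip H)
    transpose-isGeneralizedHadamard i j i≢j x = begin
      multiplicity (colDiff i j) x                       ≡⟨ cong (multiplicity (colDiff i j)) (strictlyInverseˡ x) ⟨
      multiplicity (colDiff i j) (to (from x))           ≡⟨ ℤP.i-j≡0⇒i≡j _ _ (square≡0 _ deviation≡0) ⟩
      + λ'                                               ∎
      where
      deviation≡0 : squaredDeviation i j (to (from x)) ≡ + 0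
      deviation≡0 = ∑-nonneg≡0 _ (λ y → square-nonneg (multiplicity (colDiff i j) (to y) - + λ'))
        (begin
          ∑ᴳ (squaredDeviation i j)                              ≡⟨ ∑ᴳ-squaredDeviation i j ⟩
          collisions (colDiff i j) - + N * + λ'                  ≡⟨ cong (_-_ (collisions (colDiff i j))) (collisions-rowDiff-≢ i j i≢j) ⟨
          deficiency i j                                         ≡⟨ deficiency≡0 i j ⟩
          + 0 ∎)
        (from x)

-- The matrices C_k

block-*-blockᵀ : ∀ {m m' n p p' q} (M : Fin m → Fin n → Mat p q) (M' : Fin m' → Fin n → Mat p' q) u v →
  (block M *M (block M' ᵀ)) u v
    ≡ ∑[ l < n ] ∑[ e < q ] (M (quotient p u) l (remainder {m} p u) e * M' (quotient p' v) l (remainder {m'} p' v) e)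
block-*-blockᵀ {m} {m'} {n} {p} {p'} {q} M M' u v = begin
  (block M *M (block M' ᵀ)) u v    ≡⟨ sumFin≡sum (λ r → entry (remQuot {n} q r)) ⟩
  ∑[ r < n ℕ.* q ] entry (remQuot {n} q r)
    ≡⟨ ∑-combine n q (λ r → entry (remQuot {n} q r)) ⟩
  ∑[ l < n ] ∑[ e < q ] entry (remQuot {n} q (combine l e))
    ≡⟨ sum-cong-≗ (λ l → sum-cong-≗ (λ e → cong entry (remQuot-combine l e))) ⟩
  ∑[ l < n ] ∑[ e < q ] entry (l , e) ∎
  where
  entry : Fin n × Fin q → ℤ
  entry (l , e) = M (quotient p u) l (remainder {m} p u) e * M' (quotient p' v) l (remainder {m'} p' v) e

module _ {ns : List ℕ} (nonZero : All NonZero ns) (λ' : ℕ)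
  (H : Fin (order ns ℕ.* λ') → Fin (order ns ℕ.* λ') → Grp ns) where

  open FiniteAbelianGroup (Grp-isAbelianGroup nonZero) _≟G_ (Fin↔Grp ns)
  open IsAbelianGroup (Grp-isAbelianGroup nonZero) using (assoc; identityʳ; inverseˡ)

  private
    g N : ℕ
    g = order ns
    N = order ns ℕ.* λ'

    -- A row or column index u of C_k stands for the pair (block-index u, position u).
    block-index : Fin (N ℕ.* g) → Fin N
    block-index u = quotient g u

    position : Fin (N ℕ.* g) → Grp ns
    position u = decode ns (remainder {N} g u)

  IsGH⇒IsGeneralizedHadamard : IsGH ns λ' H → IsGeneralizedHadamard λ' H
  IsGH⇒IsGeneralizedHadamard isGH i k i≢k x = begin
    ∑[ j < N ] ⟦ H i j ⊝ H k j ≟G x ⟧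
      ≡⟨ sum-cong-≗ (λ j → cong (λ b → if b then + 1 else + 0) (eqG≡does (H i j ⊝ H k j) x)) ⟨
    ∑[ j < N ] (if eqG (H i j ⊝ H k j) x then + 1 else + 0)
      ≡⟨ ∑-count (λ j → eqG (H i j ⊝ H k j) x) ⟩
    + count (λ j → eqG (H i j ⊝ H k j) x)
      ≡⟨ cong +_ (isGH i k i≢k x) ⟩
    + λ' ∎

  Cmat-*-Cmatᵀ-entry : ∀ k k' u v → (Cmat H k *M (Cmat H k' ᵀ)) u v
    ≡ ∑[ l < N ] ⟦ (position u ⊝ H k (block-index u)) ⊕ H k l ≟G (position v ⊝ H k' (block-index v)) ⊕ H k' l ⟧
  Cmat-*-Cmatᵀ-entry k k' u v = trans (block-*-blockᵀ (λ i j → φ ((⊖ H k i) ⊕ H k j)) (λ i j → φ ((⊖ H k' i) ⊕ H k' j)) u v)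
    (sum-cong-≗ (λ l → begin
      ∑[ e < g ] (φ (x l) (remainder {N} g u) e * φ (x' l) (remainder {N} g v) e)
        ≡⟨ sum-cong-≗ (λ e → cong₂ _*_ (φ-translation (x l) _ e) (φ-translation (x' l) _ e)) ⟩
      ∑ᴳ (λ y → ⟦ y ≟G a ⊕ x l ⟧ * ⟦ y ≟G b ⊕ x' l ⟧)
        ≡⟨ ∑ᴳ-⟦≟⟧-* (a ⊕ x l) (λ y → ⟦ y ≟G b ⊕ x' l ⟧) ⟩
      ⟦ a ⊕ x l ≟G b ⊕ x' l ⟧
        ≡⟨ cong₂ (λ s t → ⟦ s ≟G t ⟧) (sym (assoc a (⊖ p) (H k l))) (sym (assoc b (⊖ q) (H k' l))) ⟩
      ⟦ (a ⊝ p) ⊕ H k l ≟G (b ⊝ q) ⊕ H k' l ⟧ ∎))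
    where
    a = position u
    b = position v
    p = H k (block-index u)
    q = H k' (block-index v)
    x x' : Fin N → Grp ns
    x  l = (⊖ p) ⊕ H k l
    x' l = (⊖ q) ⊕ H k' l

  Cmat-*-Cmatᵀ≡N·Cmat : ∀ k → (Cmat H k *M (Cmat H k ᵀ)) ≈M ((+ N) ·M Cmat H k)
  Cmat-*-Cmatᵀ≡N·Cmat k u v = begin
    (Cmat H k *M (Cmat H k ᵀ)) u v                  ≡⟨ Cmat-*-Cmatᵀ-entry k k u v ⟩
    ∑[ l < N ] ⟦ (a ⊝ p) ⊕ H k l ≟G (b ⊝ q) ⊕ H k l ⟧
      ≡⟨ sum-cong-≗ (λ l → ⟦≟⟧-translate (a ⊝ p) (b ⊝ q) (H k l)) ⟩
    ∑[ l < N ] ⟦ a ⊝ p ≟G b ⊝ q ⟧                 ≡⟨ ∑-const N ⟦ a ⊝ p ≟G b ⊝ q ⟧ ⟩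
    + N * ⟦ a ⊝ p ≟G b ⊝ q ⟧                      ≡⟨ cong (+ N *_) (⟦≟∙⟧-difference a b p q) ⟨
    + N * ⟦ b ≟G a ⊕ ((⊖ p) ⊕ q) ⟧                ≡⟨ cong (+ N *_) (φ-translation ((⊖ p) ⊕ q) _ _) ⟨
    + N * Cmat H k u v                            ∎
    where
    a = position u
    b = position v
    p = H k (block-index u)
    q = H k (block-index v)

  Cmat-*-Cmat'ᵀ≡λ·J : IsGH ns λ' H → ∀ k k' → k ≢ k' →
    (Cmat H k *M (Cmat H k' ᵀ)) ≈M ((+ λ') ·M J (N ℕ.* g) (N ℕ.* g))
  Cmat-*-Cmat'ᵀ≡λ·J isGH k k' k≢k' u v = begin
    (Cmat H k *M (Cmat H k' ᵀ)) u v                  ≡⟨ Cmat-*-Cmatᵀ-entry k k' u v ⟩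
    ∑[ l < N ] ⟦ (a ⊝ p) ⊕ H k l ≟G (b ⊝ q) ⊕ H k' l ⟧
      ≡⟨ sum-cong-≗ (λ l → ⟦∙≟∙⟧ (a ⊝ p) (H k l) (b ⊝ q) (H k' l)) ⟩
    multiplicity (λ l → H k l ⊝ H k' l) ((b ⊝ q) ⊝ (a ⊝ p))
      ≡⟨ IsGH⇒IsGeneralizedHadamard isGH k k' k≢k' ((b ⊝ q) ⊝ (a ⊝ p)) ⟩
    + λ'                                            ≡⟨ ℤP.*-identityʳ (+ λ') ⟨
    + λ' * + 1                                      ∎
    where
    a = position u
    b = position v
    p = H k (block-index u)
    q = H k' (block-index v)

  private
    ∑C-closedForm : Mat (N ℕ.* g) (N ℕ.* g)
    ∑C-closedForm = ((+ N) ·M (I N ⊗ I g)) +M ((+ λ') ·M ((J N N -M I N) ⊗ J g g))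

  sumM-Cmat-entry : ∀ u v →
    sumM (Cmat H) u v ≡ ∑[ t < N ] ⟦ position v ≟G position u ⊕ ((⊖ H t (block-index u)) ⊕ H t (block-index v)) ⟧
  sumM-Cmat-entry u v = trans (sumFin≡sum (λ t → Cmat H t u v)) (sum-cong-≗ (λ t →
    φ-translation ((⊖ H t (block-index u)) ⊕ H t (block-index v)) (remainder {N} g u) (remainder {N} g v)))

  sumM-Cmat-sameBlock : ∀ u v → block-index u ≡ block-index v → sumM (Cmat H) u v ≡ ∑C-closedForm u v
  sumM-Cmat-sameBlock u v i≡j = begin
    sumM (Cmat H) u v                                ≡⟨ sumM-Cmat-entry u v ⟩
    ∑[ t < N ] ⟦ b ≟G a ⊕ ((⊖ H t i) ⊕ H t j) ⟧       ≡⟨ sum-cong-≗ (λ t → cong (λ s → ⟦ b ≟G s ⟧) (translation-trivial t)) ⟩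
    ∑[ t < N ] ⟦ b ≟G a ⟧                            ≡⟨ ∑-const N ⟦ b ≟G a ⟧ ⟩
    + N * ⟦ b ≟G a ⟧                                 ≡⟨ cong (+ N *_) (trans (⟦to≟to⟧ rv ru) (δ-sym rv ru)) ⟩
    + N * δ ru rv                                    ≡⟨ diagonal (+ N) (+ λ') (δ ru rv) ⟩
    + N * (+ 1 * δ ru rv) + + λ' * ((+ 1 - + 1) * + 1)
      ≡⟨ cong (λ d → + N * (d * δ ru rv) + + λ' * ((+ 1 - d) * + 1)) (⟦⟧-yes (i ≟F j) i≡j) ⟨
    + N * (δ i j * δ ru rv) + + λ' * ((+ 1 - δ i j) * + 1) ∎
    where
    i = block-index u
    j = block-index v
    ru = remainder {N} g u
    rv = remainder {N} g v
    a = position u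
    b = position v
    translation-trivial : ∀ t → a ⊕ ((⊖ H t i) ⊕ H t j) ≡ a
    translation-trivial t = begin
      a ⊕ ((⊖ H t i) ⊕ H t j)  ≡⟨ cong (λ h → a ⊕ ((⊖ H t h) ⊕ H t j)) i≡j ⟩
      a ⊕ ((⊖ H t j) ⊕ H t j)  ≡⟨ cong (a ⊕_) (inverseˡ (H t j)) ⟩
      a ⊕ 0G nonZero           ≡⟨ identityʳ a ⟩
      a                        ∎
    diagonal : ∀ n l d → n * d ≡ n * (+ 1 * d) + l * ((+ 1 - + 1) * + 1)
    diagonal = solve-∀

  sumM-Cmat-distinctBlocks : IsGH ns λ' H → ∀ u v → block-index u ≢ block-index v →
    sumM (Cmat H) u v ≡ ∑C-closedForm u v
  sumM-Cmat-distinctBlocks isGH u v i≢j = begin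
    sumM (Cmat H) u v                                ≡⟨ sumM-Cmat-entry u v ⟩
    ∑[ t < N ] ⟦ b ≟G a ⊕ ((⊖ H t i) ⊕ H t j) ⟧
      ≡⟨ sum-cong-≗ (λ t → trans (⟦≟∙⟧-difference a b (H t i) (H t j))
                        (trans (⟦≟⟧-cross a (H t i) b (H t j)) (⟦≟⟧-sym (a ⊝ b) (H t i ⊝ H t j)))) ⟩
    multiplicity (λ t → H t i ⊝ H t j) (a ⊝ b)
      ≡⟨ transpose-isGeneralizedHadamard (ℤP.pos-* g λ') (IsGH⇒IsGeneralizedHadamard isGH) i j i≢j (a ⊝ b) ⟩
    + λ'                                             ≡⟨ offDiagonal (+ N) (+ λ') (δ ru rv) ⟩
    + N * (+ 0 * δ ru rv) + + λ' * ((+ 1 - + 0) * + 1)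
      ≡⟨ cong (λ d → + N * (d * δ ru rv) + + λ' * ((+ 1 - d) * + 1)) (⟦⟧-no (i ≟F j) i≢j) ⟨
    + N * (δ i j * δ ru rv) + + λ' * ((+ 1 - δ i j) * + 1) ∎
    where
    i = block-index u
    j = block-index v
    ru = remainder {N} g u
    rv = remainder {N} g v
    a = position u
    b = position v
    offDiagonal : ∀ n l d → l ≡ n * (+ 0 * d) + l * ((+ 1 - + 0) * + 1)
    offDiagonal = solve-∀

  sumM-Cmat : IsGH ns λ' H → sumM (Cmat H) ≈M ∑C-closedForm
  sumM-Cmat isGH u v =
    [ sumM-Cmat-sameBlock u v , sumM-Cmat-distinctBlocks isGH u v ]′ (toSum (block-index u ≟F block-index v))

lemma2p8 : (ns : List ℕ) → All NonZero ns → (λ' : ℕ) →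
    (H : Fin (order ns ℕ.* λ') → Fin (order ns ℕ.* λ') → Grp ns) → IsGH ns λ' H →
      (sumM (Cmat H)
         ≈M (((+ (order ns ℕ.* λ')) ·M (I (order ns ℕ.* λ') ⊗ I (order ns)))
            +M ((+ λ') ·M ((J (order ns ℕ.* λ') (order ns ℕ.* λ') -M I (order ns ℕ.* λ')) ⊗ J (order ns) (order ns)))))
      × (∀ k → (Cmat H k *M (Cmat H k ᵀ)) ≈M ((+ (order ns ℕ.* λ')) ·M Cmat H k))
      × (∀ k k' → k ≢ k' → (Cmat H k *M (Cmat H k' ᵀ))
           ≈M ((+ λ') ·M J (order ns ℕ.* λ' ℕ.* order ns) (order ns ℕ.* λ' ℕ.* order ns)))
lemma2p8 ns nonZero λ' H isGH =
  sumM-Cmat nonZero λ' H isGH , Cmat-*-Cmatᵀ≡N·Cmat nonZero λ' H , Cmat-*-Cmat'ᵀ≡λ·J nonZero λ' H isGH
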